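{- Let $L$ be a pretransitive normal modal logic with canonical frame $F=(X,R)$. Let $a\in X$ and let $\varphi$ be a formula with $\varphi\in b$ for some $b\in R(a)$. Then the set $R(a)\cap\{b\in X:\varphi\in b\}$ has a maximal element, i.e. an element $c$ of this set such that for every $d$ in the set, $cR^*d$ implies $dR^*c$.
   Context: A normal modal logic is pretransitive if it contains $\lozenge^{m+1}p\to\bigvee_{i\le m}\lozenge^ip$ for some $m\ge0$. The canonical frame of $L$ has as points the maximal $L$-consistent sets of formulas, with $aRb$ iff $\{\varphi:\Box\varphi\in a\}\subseteq b$; $R(a)=\{b:aRb\}$, and $R^*$ is the reflexive transitive closure of $R$. -}

module Defs where

open import Data.Nat using (ℕ; zero; suc)
open import Data.Bool using (Bool; true; false; not; _∨_)
open import Data.List using (List; []; _∷_)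
open import Data.List.Relation.Unary.All using (All)
open import Data.Product using (Σ; _×_; ∃; _,_)
open import Relation.Binary.PropositionalEquality using (_≡_)
open import Relation.Nullary using (¬_)
open import Relation.Binary.Construct.Closure.ReflexiveTransitive using (Star)
open import Level using (0ℓ)

infixr 5 _⇒_

data Form : Set where
  var : ℕ → Form
  ⊥'  : Form
  _⇒_ : Form → Form → Form
  □_  : Form → Form

¬'_ : Form → Form
¬' φ = φ ⇒ ⊥'

⊤' : Form
⊤' = ¬' ⊥'

_∨'_ : Form → Form → Form
φ ∨' ψ = (¬' φ) ⇒ ψ

_∧'_ : Form → Form → Form
φ ∧' ψ = ¬' (φ ⇒ ¬' ψ)

◇_ : Form → Form
◇ φ = ¬' (□ (¬' φ))

◇^ : ℕ → Form → Form
◇^ zero    φ = φ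
◇^ (suc n) φ = ◇ (◇^ n φ)

⋀ : List Form → Form
⋀ []       = ⊤'
⋀ (φ ∷ φs) = φ ∧' ⋀ φs

subst : (ℕ → Form) → Form → Form
subst σ (var n) = σ n
subst σ ⊥'      = ⊥'
subst σ (φ ⇒ ψ) = subst σ φ ⇒ subst σ ψ
subst σ (□ φ)   = □ (subst σ φ)

eval : (ℕ → Bool) → (Form → Bool) → Form → Bool
eval v w (var n) = v n
eval v w ⊥'      = false
eval v w (φ ⇒ ψ) = not (eval v w φ) ∨ eval v w ψ
eval v w (□ φ)   = w φ

Tautology : Form → Set
Tautology φ = ∀ (v : ℕ → Bool) (w : Form → Bool) → eval v w φ ≡ true

Logic : Set₁
Logic = Form → Set

record NormalModalLogic (L : Logic) : Set where
  field
    taut  : ∀ φ → Tautology φ → L φ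
    axK   : ∀ φ ψ → L (□ (φ ⇒ ψ) ⇒ (□ φ ⇒ □ ψ))
    mp    : ∀ φ ψ → L (φ ⇒ ψ) → L φ → L ψ
    nec   : ∀ φ → L φ → L (□ φ)
    usubst : ∀ (σ : ℕ → Form) φ → L φ → L (subst σ φ)

⋁◇ : ℕ → Form → Form
⋁◇ zero    p = p
⋁◇ (suc m) p = ⋁◇ m p ∨' ◇^ (suc m) p

p₀ : Form
p₀ = var 0

Pretransitive : Logic → Set
Pretransitive L = Σ ℕ λ m → L (◇^ (suc m) p₀ ⇒ ⋁◇ m p₀)

FormSet : Set₁
FormSet = Form → Set

_⊆_ : FormSet → FormSet → Set
Γ ⊆ Δ = ∀ φ → Γ φ → Δ φ

Consistent : Logic → FormSet → Set
Consistent L Γ = ¬ (Σ (List Form) λ φs → All Γ φs × L (¬' (⋀ φs)))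

MaxConsistent : Logic → FormSet → Set₁
MaxConsistent L Γ = Consistent L Γ × (∀ Δ → Γ ⊆ Δ → Consistent L Δ → Δ ⊆ Γ)

CanPoint : Logic → Set₁
CanPoint L = Σ FormSet (MaxConsistent L)

carrier : (L : Logic) → CanPoint L → FormSet
carrier L (Γ , _) = Γ

CanR : (L : Logic) → CanPoint L → CanPoint L → Set
CanR L a b = ∀ φ → carrier L a (□ φ) → carrier L b φ

CanR* : (L : Logic) → CanPoint L → CanPoint L → Set₁
CanR* L = Star (CanR L)

{-# OPTIONS --safe #-}
module Submission where

open import Defs
open import Data.Product using (Σ; _×_)

open import Data.Bool using (Bool; true; false; not; _∨_)
open import Data.Empty using (⊥; ⊥-elim)
open import Data.List using (List; []; _∷_; _++_)
open import Data.List.Relation.Unary.All using (All; []; _∷_)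
import Data.List.Relation.Unary.All as All
open import Data.List.Relation.Unary.All.Properties using (++⁺; ++⁻)
open import Data.Nat
  using (ℕ; zero; suc; _+_; _*_; _∸_; _≤_; _≤′_; ≤′-refl; ≤′-step; _⊔_; z≤n; s≤s; _!)
open import Data.Nat.Properties
  using ( +-suc; +-identityʳ; ≤-refl; ≤-trans; m≤n⇒m≤1+n; m≤n⇒m<n∨m≡n; ≤⇒≤′
        ; m≤m⊔n; m≤n⊔m; +-monoʳ-≤; m+n∸n≡m; 1≤n!; 1+n≰n)
open import Data.Nat.Divisibility using (divides; m∣m*n; ∣-trans; m≤n⇒m!∣n!)
open import Data.Nat.Solver using (module +-*-Solver)
open import Data.Product using (∃; _,_; proj₁; proj₂)
open import Data.Sum using (_⊎_; inj₁; inj₂)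
open import Function using (_∘_)
open import Relation.Binary.Construct.Closure.ReflexiveTransitive using (Star; ε; _◅_)
open import Relation.Binary.PropositionalEquality
  using (_≡_; refl; sym; trans; cong; cong₂; module ≡-Reasoning) renaming (subst to ≡-subst)
open import Relation.Nullary using (¬_)
open import Relation.Nullary.Negation using (¬¬-map)
open import Relation.Unary using (_∪_; ｛_｝)

-- Write ⊟χ (unreachable χ below) for ¬ ⋁_{i≤m} ◇ⁱχ.  By pretransitivity ⊟χ ∈ x says that
-- no ◇ʲχ lies in x, so ⊟-formulas persist along R*.  The maximal element c is a Lindenbaum
-- extension of {χ : □χ ∈ a} ∪ {φ} that, running through all formulas χ, also takes in ⊟χ
-- whenever this keeps it consistent.  If c R⁺ d with d ∈ R(a) ∩ [φ], the ⊟-formulas of c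
-- persist to d, so every ⊟χ ∈ d could have been taken in and lies in c: no χ ∈ c has ⊟χ ∈ d.
-- As c is closed under ∧, one i ≤ m then has ◇ⁱψ ∈ d for all ψ ∈ c.  Constructively this i
-- exists only under ¬¬, so we use a single length K that, for every i ≤ m, is the length of
-- d →ⁱ c followed by rounds of the cycle c →⁺ d →ⁱ c; "◇ᴷψ ∈ d for all ψ ∈ c" is ¬¬-stable,
-- and the existence lemma turns it into an R-path from d to c.

◇^-+ : ∀ j k ψ → ◇^ j (◇^ k ψ) ≡ ◇^ (j + k) ψ
◇^-+ zero    k ψ = refl
◇^-+ (suc j) k ψ = cong ◇_ (◇^-+ j k ψ)

◇^-suc : ∀ i ψ → ◇^ i (◇ ψ) ≡ ◇^ (suc i) ψ
◇^-suc zero    ψ = refl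
◇^-suc (suc i) ψ = cong ◇_ (◇^-suc i ψ)

subst-◇^ : ∀ σ k ψ → subst σ (◇^ k ψ) ≡ ◇^ k (subst σ ψ)
subst-◇^ σ zero    ψ = refl
subst-◇^ σ (suc k) ψ = cong ◇_ (subst-◇^ σ k ψ)

subst-⋁◇ : ∀ σ k ψ → subst σ (⋁◇ k ψ) ≡ ⋁◇ k (subst σ ψ)
subst-⋁◇ σ zero    ψ = refl
subst-⋁◇ σ (suc k) ψ = cong₂ _∨'_ (subst-⋁◇ σ k ψ) (subst-◇^ σ (suc k) ψ)

nextPair : ℕ × ℕ → ℕ × ℕ
nextPair (i , suc j) = suc i , j
nextPair (i , zero)  = zero , suc i

unpair : ℕ → ℕ × ℕ
unpair zero    = 0 , 0
unpair (suc n) = nextPair (unpair n)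

unpair-surjective : ∀ i j → ∃ λ n → unpair n ≡ (i , j)
unpair-surjective i j = diagonal (i + j) i j refl
  where
  next : ∀ {p} → ∃ (λ n → unpair n ≡ p) → ∃ λ n → unpair n ≡ nextPair p
  next (n , eq) = suc n , cong nextPair eq

  diagonal : ∀ s i j → i + j ≡ s → ∃ λ n → unpair n ≡ (i , j)
  diagonal s       (suc i) j        eq   = next (diagonal s i (suc j) (trans (+-suc i j) eq))
  diagonal zero    zero    zero     _    = 0 , refl
  diagonal (suc s) zero    .(suc s) refl = next (diagonal s s 0 (+-identityʳ s))

pair : ℕ → ℕ → ℕ
pair i j = proj₁ (unpair-surjective i j)

unpair-pair : ∀ i j → unpair (pair i j) ≡ (i , j)
unpair-pair i j = proj₂ (unpair-surjective i j)

-- A code unpairs into a constructor tag and a payload; the fuel bounds the depth.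
mutual
  decodeWith : ℕ → ℕ → Form
  decodeWith zero    _ = ⊥'
  decodeWith (suc f) n = decodeNode f (unpair n)

  decodeNode : ℕ → ℕ × ℕ → Form
  decodeNode f (0 , n)                 = var n
  decodeNode f (1 , _)                 = ⊥'
  decodeNode f (2 , n)                 = let i , j = unpair n in decodeWith f i ⇒ decodeWith f j
  decodeNode f (suc (suc (suc _)) , n) = □ decodeWith f n

encode : Form → ℕ
encode (var n) = pair 0 n
encode ⊥'      = pair 1 0
encode (α ⇒ β) = pair 2 (pair (encode α) (encode β))
encode (□ α)   = pair 3 (encode α)

depth : Form → ℕ
depth (var _) = 1
depth ⊥'      = 1
depth (α ⇒ β) = suc (depth α ⊔ depth β)
depth (□ α)   = suc (depth α)

decodeWith-encode : ∀ φ {f} → depth φ ≤ f → decodeWith f (encode φ) ≡ φ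
decodeWith-encode (var n) (s≤s _) rewrite unpair-pair 0 n = refl
decodeWith-encode ⊥'      (s≤s _) rewrite unpair-pair 1 0 = refl
decodeWith-encode (α ⇒ β) {suc f} (s≤s d≤f)
  rewrite unpair-pair 2 (pair (encode α) (encode β)) | unpair-pair (encode α) (encode β) =
  cong₂ _⇒_ (decodeWith-encode α (≤-trans (m≤m⊔n _ _) d≤f))
            (decodeWith-encode β (≤-trans (m≤n⊔m _ _) d≤f))
decodeWith-encode (□ α) (s≤s d≤f) rewrite unpair-pair 3 (encode α) =
  cong □_ (decodeWith-encode α d≤f)

decode : ℕ → Form
decode n = decodeWith (proj₁ (unpair n)) (proj₂ (unpair n))

decode-surjective : ∀ φ → ∃ λ n → decode n ≡ φ
decode-surjective φ = pair (depth φ) (encode φ) , eq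
  where
  eq : decode (pair (depth φ) (encode φ)) ≡ φ
  eq rewrite unpair-pair (depth φ) (encode φ) = decodeWith-encode φ ≤-refl

module Valuation (v : ℕ → Bool) (w : Form → Bool) where

  record Holds (φ : Form) : Set where
    constructor holds
    field truth : eval v w φ ≡ true
  open Holds public

  ¬Holds-⊥ : ¬ Holds ⊥'
  ¬Holds-⊥ (holds ())

  Holds-stable : ∀ {α} → ¬ ¬ Holds α → Holds α
  Holds-stable {α} nn = holds (stable (eval v w α) λ b≢true → nn (b≢true ∘ truth))
    where
    stable : ∀ b → ¬ ¬ b ≡ true → b ≡ true
    stable true  _  = refl
    stable false nn = ⊥-elim (nn λ ())

  ⇒⁺ : ∀ {α β} → (Holds α → Holds β) → Holds (α ⇒ β)
  ⇒⁺ {α} f = holds (material (eval v w α) (truth ∘ f ∘ holds))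
    where
    material : ∀ a {b} → (a ≡ true → b ≡ true) → not a ∨ b ≡ true
    material false _ = refl
    material true  k = k refl

  ⇒⁻ : ∀ {α β} → Holds (α ⇒ β) → Holds α → Holds β
  ⇒⁻ (holds h) (holds a) = holds (modus-ponens h a)
    where
    modus-ponens : ∀ {a b} → not a ∨ b ≡ true → a ≡ true → b ≡ true
    modus-ponens h refl = h

  ¬⁺ : ∀ {α} → ¬ Holds α → Holds (¬' α)
  ¬⁺ n = ⇒⁺ (⊥-elim ∘ n)

  ¬⁻ : ∀ {α} → Holds (¬' α) → ¬ Holds α
  ¬⁻ h a = ¬Holds-⊥ (⇒⁻ h a)

  ∧⁺ : ∀ {α β} → Holds α → Holds β → Holds (α ∧' β)
  ∧⁺ a b = ¬⁺ λ h → ¬⁻ (⇒⁻ h a) b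

  ∧⁻ : ∀ {α β} → Holds (α ∧' β) → Holds α × Holds β
  ∧⁻ h = Holds-stable (λ na → ¬⁻ h (⇒⁺ (⊥-elim ∘ na)))
       , Holds-stable (λ nb → ¬⁻ h (⇒⁺ λ _ → ¬⁺ nb))

  ⋀⁺ : ∀ {φs} → All Holds φs → Holds (⋀ φs)
  ⋀⁺ []       = ¬⁺ ¬Holds-⊥
  ⋀⁺ (h ∷ hs) = ∧⁺ h (⋀⁺ hs)

  ⋀⁻ : ∀ φs → Holds (⋀ φs) → All Holds φs
  ⋀⁻ []       _ = []
  ⋀⁻ (φ ∷ φs) h = let a , b = ∧⁻ h in a ∷ ⋀⁻ φs b

infix 3 _⊨_
_⊨_ : List Form → Form → Set
φs ⊨ ψ = ∀ v w → All (Valuation.Holds v w) φs → Valuation.Holds v w ψ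

contraposition : ∀ {α β} → (α ⇒ β) ∷ [] ⊨ (¬' β ⇒ ¬' α)
contraposition v w (h ∷ []) = ⇒⁺ λ nb → ¬⁺ λ a → ¬⁻ nb (⇒⁻ h a)
  where open Valuation v w

partition-∪ : ∀ {Γ Δ : FormSet} {φs} → All (Γ ∪ Δ) φs →
  Σ (List Form) λ γs → Σ (List Form) λ δs →
    All Γ γs × All Δ δs × (∀ {P : FormSet} → All P (γs ++ δs) → All P φs)
partition-∪ [] = [] , [] , [] , [] , λ _ → []
partition-∪ (inj₁ γ ∷ rest) =
  let γs , δs , γs∈Γ , δs∈Δ , covers = partition-∪ rest
  in  _ ∷ γs , δs , γ ∷ γs∈Γ , δs∈Δ , λ { (p ∷ ps) → p ∷ covers ps }
partition-∪ (inj₂ δ ∷ rest) =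
  let γs , δs , γs∈Γ , δs∈Δ , covers = partition-∪ rest
  in  γs , _ ∷ δs , γs∈Γ , δ ∷ δs∈Δ , λ ps →
        let pγs , pδ∷pδs = ++⁻ γs ps
        in  All.head pδ∷pδs ∷ covers (++⁺ pγs (All.tail pδ∷pδs))

module NormalLogic {L : Logic} (N : NormalModalLogic L) where
  open NormalModalLogic N

  L-closed : ∀ {αs γ} → All L αs → αs ⊨ γ → L γ
  L-closed             []       αs⊨γ = taut _ λ v w → Valuation.truth (αs⊨γ v w [])
  L-closed {α ∷ _} {γ} (p ∷ ps) αs⊨γ =
    mp α γ (L-closed ps λ v w hs → Valuation.⇒⁺ v w λ h → αs⊨γ v w (h ∷ hs)) p

  ⊤-theorem : L ⊤'
  ⊤-theorem = L-closed [] λ v w _ → Valuation.⋀⁺ v w []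

  ∧-intro : ∀ {α β} → L (α ⇒ β ⇒ α ∧' β)
  ∧-intro = L-closed [] λ v w _ → let open Valuation v w in ⇒⁺ λ a → ⇒⁺ λ b → ∧⁺ a b

  ∧-elimˡ : ∀ {α β} → L (α ∧' β ⇒ α)
  ∧-elimˡ = L-closed [] λ v w _ → let open Valuation v w in ⇒⁺ λ h → proj₁ (∧⁻ h)

  ∧-elimʳ : ∀ {α β} → L (α ∧' β ⇒ β)
  ∧-elimʳ = L-closed [] λ v w _ → let open Valuation v w in ⇒⁺ λ h → proj₂ (∧⁻ h)

  □-mono : ∀ {α β} → L (α ⇒ β) → L (□ α ⇒ □ β)
  □-mono {α} {β} p = mp _ _ (axK α β) (nec _ p)

  ◇-mono : ∀ {α β} → L (α ⇒ β) → L (◇ α ⇒ ◇ β)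
  ◇-mono p = L-closed (□-mono (L-closed (p ∷ []) contraposition) ∷ []) contraposition

  ◇^-mono : ∀ k {α β} → L (α ⇒ β) → L (◇^ k α ⇒ ◇^ k β)
  ◇^-mono zero    p = p
  ◇^-mono (suc k) p = ◇-mono (◇^-mono k p)

  Consistent-⊆ : ∀ {Γ Δ} → Γ ⊆ Δ → Consistent L Δ → Consistent L Γ
  Consistent-⊆ Γ⊆Δ con (φs , φs∈Γ , p) = con (φs , All.map (Γ⊆Δ _) φs∈Γ , p)

  ∪-consistent : ∀ {Γ Δ} → (∀ {γs δs} → All Γ γs → All Δ δs → L (¬' ⋀ (γs ++ δs)) → ⊥) →
                 Consistent L (Γ ∪ Δ)
  ∪-consistent refute (φs , φs∈Γ∪Δ , p) =
    let γs , δs , γs∈Γ , δs∈Δ , covers = partition-∪ φs∈Γ∪Δ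
    in  refute γs∈Γ δs∈Δ (L-closed (p ∷ []) λ { v w (h ∷ []) → let open Valuation v w in
          ¬⁺ λ t → ¬⁻ h (⋀⁺ (covers (⋀⁻ (γs ++ δs) t))) })

  infix 4 _∋_
  _∋_ : CanPoint L → Form → Set
  x ∋ φ = carrier L x φ

  module Point (x : CanPoint L) where

    consistent : Consistent L (carrier L x)
    consistent = proj₁ (proj₂ x)

    ⊆⇒⊇ : (y : CanPoint L) → carrier L x ⊆ carrier L y → carrier L y ⊆ carrier L x
    ⊆⇒⊇ y x⊆y = proj₂ (proj₂ x) (carrier L y) x⊆y (proj₁ (proj₂ y))

    ∋-by-refutation : ∀ {θ} → (∀ {γs} → All (x ∋_) γs → L (¬' ⋀ (θ ∷ γs)) → ⊥) → x ∋ θ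
    ∋-by-refutation {θ} refute =
      proj₂ (proj₂ x) (carrier L x ∪ ｛ θ ｝) (λ _ → inj₁) (∪-consistent refute′) θ (inj₂ refl)
      where
      refute′ : ∀ {γs δs} → All (x ∋_) γs → All ｛ θ ｝ δs → L (¬' ⋀ (γs ++ δs)) → ⊥
      refute′ {γs} γs∈x δs≡θ p = refute γs∈x (L-closed (p ∷ []) λ { v w (h ∷ []) →
        let open Valuation v w in ¬⁺ λ t → let tθ , tγs = ∧⁻ t in
          ¬⁻ h (⋀⁺ (++⁺ (⋀⁻ γs tγs) (All.map (λ { refl → tθ }) δs≡θ))) })

    ∋-stable : ∀ {θ} → ¬ ¬ x ∋ θ → x ∋ θ
    ∋-stable nn = ∋-by-refutation λ γs∈x p → nn λ θ∈x → consistent (_ , θ∈x ∷ γs∈x , p)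

    ∋-closed : ∀ {φs θ} → All (x ∋_) φs → φs ⊨ θ → x ∋ θ
    ∋-closed {φs} φs∈x φs⊨θ = ∋-by-refutation λ {γs} γs∈x p →
      consistent (φs ++ γs , ++⁺ φs∈x γs∈x , L-closed (p ∷ []) λ { v w (h ∷ []) →
        let open Valuation v w in ¬⁺ λ t → let tφs , tγs = ++⁻ φs (⋀⁻ (φs ++ γs) t) in
          ¬⁻ h (∧⁺ (φs⊨θ v w tφs) (⋀⁺ tγs)) })

    ∋-theorem : ∀ {θ} → L θ → x ∋ θ
    ∋-theorem ⊢θ = ∋-by-refutation λ γs∈x p →
      consistent (_ , γs∈x , L-closed (p ∷ ⊢θ ∷ []) λ { v w (h ∷ t ∷ []) →
        let open Valuation v w in ¬⁺ λ tγs → ¬⁻ h (∧⁺ t tγs) })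

    ∌-⊥ : ¬ x ∋ ⊥'
    ∌-⊥ ⊥∈x = consistent (⊥' ∷ [] , ⊥∈x ∷ [] , L-closed [] λ v w _ →
      let open Valuation v w in ¬⁺ λ t → ¬Holds-⊥ (proj₁ (∧⁻ t)))

    ∋-⇒⁻ : ∀ {α β} → x ∋ α ⇒ β → x ∋ α → x ∋ β
    ∋-⇒⁻ h a = ∋-closed (h ∷ a ∷ []) λ { v w (h ∷ a ∷ []) → Valuation.⇒⁻ v w h a }

    -- A refutation of α ⇒ β together with γs puts both α and ¬β into x.
    ∋-⇒⁺ : ∀ {α β} → (x ∋ α → x ∋ β) → x ∋ α ⇒ β
    ∋-⇒⁺ f = ∋-by-refutation λ γs∈x p →
      let α∈x  = ∋-closed (∋-theorem p ∷ γs∈x) λ { v w (h ∷ hs) → let open Valuation v w in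
                   Holds-stable λ na → ¬⁻ h (∧⁺ (⇒⁺ (⊥-elim ∘ na)) (⋀⁺ hs)) }
          ¬β∈x = ∋-closed (∋-theorem p ∷ γs∈x) λ { v w (h ∷ hs) → let open Valuation v w in
                   ¬⁺ λ b → ¬⁻ h (∧⁺ (⇒⁺ λ _ → b) (⋀⁺ hs)) }
      in  ∌-⊥ (∋-⇒⁻ ¬β∈x (f α∈x))

    ∋-¬⁺ : ∀ {α} → ¬ x ∋ α → x ∋ ¬' α
    ∋-¬⁺ n = ∋-⇒⁺ (⊥-elim ∘ n)

    ∋-¬⁻ : ∀ {α} → x ∋ ¬' α → ¬ x ∋ α
    ∋-¬⁻ h a = ∌-⊥ (∋-⇒⁻ h a)

    ∋-∧⁺ : ∀ {α β} → x ∋ α → x ∋ β → x ∋ α ∧' β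
    ∋-∧⁺ a b = ∋-¬⁺ λ h → ∋-¬⁻ (∋-⇒⁻ h a) b

    ∋-∨⁺ˡ : ∀ {α β} → x ∋ α → x ∋ α ∨' β
    ∋-∨⁺ˡ a = ∋-⇒⁺ λ na → ⊥-elim (∋-¬⁻ na a)

    ∋-∨⁺ʳ : ∀ {α β} → x ∋ β → x ∋ α ∨' β
    ∋-∨⁺ʳ b = ∋-⇒⁺ λ _ → b

    ∌-∨ : ∀ {α β} → ¬ x ∋ α → ¬ x ∋ β → ¬ x ∋ α ∨' β
    ∌-∨ na nb h = nb (∋-⇒⁻ h (∋-¬⁺ na))

    ∋-mono : ∀ {α β} → L (α ⇒ β) → x ∋ α → x ∋ β
    ∋-mono p = ∋-⇒⁻ (∋-theorem p)

    ∋-□-⋀ : ∀ {χs} → All (λ χ → x ∋ □ χ) χs → x ∋ □ ⋀ χs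
    ∋-□-⋀ []       = ∋-theorem (nec _ ⊤-theorem)
    ∋-□-⋀ (h ∷ hs) = □-mp (□-mp (∋-theorem (nec _ ∧-intro)) h) (∋-□-⋀ hs)
      where
      □-mp : ∀ {α β} → x ∋ □ (α ⇒ β) → x ∋ □ α → x ∋ □ β
      □-mp = ∋-⇒⁻ ∘ ∋-⇒⁻ (∋-theorem (axK _ _))

  open Point public

  module Lindenbaum (Γ : FormSet) (f : ℕ → Form) where

    -- Consistency is undecidable, so f n enters stage (suc n) together with a proof
    -- that adding it to stage n is consistent.
    mutual
      stage : ℕ → FormSet
      stage zero    = Γ
      stage (suc n) = stage n ∪ admitted n

      admitted : ℕ → FormSet
      admitted n χ = f n ≡ χ × Consistent L (stage n ∪ ｛ f n ｝)

    limit : FormSet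
    limit χ = ∃ λ n → stage n χ

    Γ⊆limit : Γ ⊆ limit
    Γ⊆limit _ h = 0 , h

    limit-admits : ∀ n → Consistent L (stage n ∪ ｛ f n ｝) → limit (f n)
    limit-admits n con = suc n , inj₂ (refl , con)

    stage-origin : ∀ n → stage n ⊆ (Γ ∪ λ χ → ∃ λ j → f j ≡ χ)
    stage-origin zero    χ h               = inj₁ h
    stage-origin (suc n) χ (inj₁ h)        = stage-origin n χ h
    stage-origin (suc n) χ (inj₂ (eq , _)) = inj₂ (n , eq)

    stage-mono : ∀ {m n} → m ≤′ n → stage m ⊆ stage n
    stage-mono ≤′-refl        _ h = h
    stage-mono (≤′-step m≤n) χ h = inj₁ (stage-mono m≤n χ h)

    limit-finite : ∀ {φs} → All limit φs → ∃ λ n → All (stage n) φs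
    limit-finite []               = 0 , []
    limit-finite ((m , h) ∷ rest) =
      let n , hs = limit-finite rest
      in  m ⊔ n , stage-mono (≤⇒≤′ (m≤m⊔n m n)) _ h
                ∷ All.map (stage-mono (≤⇒≤′ (m≤n⊔m m n)) _) hs

    stage-consistent : Consistent L Γ → ∀ n → Consistent L (stage n)
    stage-consistent con zero    = con
    stage-consistent con (suc n) = ∪-consistent refute
      where
      refute : ∀ {γs δs} → All (stage n) γs → All (admitted n) δs → L (¬' ⋀ (γs ++ δs)) → ⊥
      refute γs∈ []                        p = stage-consistent con n (_ , ++⁺ γs∈ [] , p)
      refute γs∈ δs∈@((_ , admissible) ∷ _) p =
        admissible (_ , ++⁺ (All.map inj₁ γs∈) (All.map (inj₂ ∘ proj₁) δs∈) , p)

    limit-consistent : Consistent L Γ → Consistent L limit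
    limit-consistent con (φs , φs∈limit , p) =
      let n , φs∈stage = limit-finite φs∈limit in stage-consistent con n (φs , φs∈stage , p)

  lindenbaum : ∀ {Γ} → Consistent L Γ → Σ (CanPoint L) λ x → Γ ⊆ carrier L x
  lindenbaum {Γ} con = (limit , limit-consistent con , maximal) , Γ⊆limit
    where
    open Lindenbaum Γ decode
    maximal : ∀ Δ → limit ⊆ Δ → Consistent L Δ → Δ ⊆ limit
    maximal Δ limit⊆Δ conΔ ψ ψ∈Δ with decode-surjective ψ
    ... | n , refl = limit-admits n (Consistent-⊆ stage+ψ⊆Δ conΔ)
      where
      stage+ψ⊆Δ : (stage n ∪ ｛ decode n ｝) ⊆ Δ
      stage+ψ⊆Δ χ (inj₁ h)    = limit⊆Δ χ (n , h)
      stage+ψ⊆Δ χ (inj₂ refl) = ψ∈Δ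

  □⁻¹ : CanPoint L → FormSet
  □⁻¹ x χ = x ∋ □ χ

  existence : ∀ x (Δ : FormSet) → (∀ {δs} → All Δ δs → x ∋ ◇ ⋀ δs) →
              Σ (CanPoint L) λ e → CanR L x e × Δ ⊆ carrier L e
  existence x Δ ◇⋀Δ∈x =
    let e , □⁻¹x∪Δ⊆e = lindenbaum (∪-consistent refute)
    in  e , (λ χ → □⁻¹x∪Δ⊆e χ ∘ inj₁) , (λ χ → □⁻¹x∪Δ⊆e χ ∘ inj₂)
    where
    refute : ∀ {γs δs} → All (□⁻¹ x) γs → All Δ δs → L (¬' ⋀ (γs ++ δs)) → ⊥
    refute {γs} {δs} □γs∈x δs∈Δ p =
      ∋-¬⁻ x (◇⋀Δ∈x δs∈Δ) (∋-mono x (□-mono γs⇒¬δs) (∋-□-⋀ x □γs∈x))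
      where
      γs⇒¬δs : L (⋀ γs ⇒ ¬' ⋀ δs)
      γs⇒¬δs = L-closed (p ∷ []) λ { v w (h ∷ []) → let open Valuation v w in
        ⇒⁺ λ tγs → ¬⁺ λ tδs → ¬⁻ h (⋀⁺ (++⁺ (⋀⁻ γs tγs) (⋀⁻ δs tδs))) }

  -- x R^k y in the canonical frame, in its diamond form ◇^k[y] ⊆ x.
  record CanR^ (k : ℕ) (x y : CanPoint L) : Set where
    constructor ◇^-reach
    field ◇^∈ : ∀ {ψ} → y ∋ ψ → x ∋ ◇^ k ψ
  open CanR^ public

  CanR^-∘ : ∀ {j k x y z} → CanR^ j x y → CanR^ k y z → CanR^ (j + k) x z
  CanR^-∘ {j} {k} {x} r s =
    ◇^-reach λ {ψ} ψ∈z → ≡-subst (x ∋_) (◇^-+ j k ψ) (◇^∈ r (◇^∈ s ψ∈z))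

  CanR^-iterate : ∀ {k x} → CanR^ k x x → ∀ t → CanR^ (t * k) x x
  CanR^-iterate r zero    = ◇^-reach λ h → h
  CanR^-iterate r (suc t) = CanR^-∘ r (CanR^-iterate r t)

  CanR^-stable : ∀ {k x y} → ¬ ¬ CanR^ k x y → CanR^ k x y
  CanR^-stable {x = x} nn = ◇^-reach λ ψ∈y → ∋-stable x λ n → nn λ r → n (◇^∈ r ψ∈y)

  CanR⇒CanR^1 : ∀ {x y} → CanR L x y → CanR^ 1 x y
  CanR⇒CanR^1 {x} {y} xRy = ◇^-reach λ ψ∈y → ∋-¬⁺ x λ □¬ψ∈x → ∋-¬⁻ y (xRy _ □¬ψ∈x) ψ∈y

  Star⇒CanR^ : ∀ {x y} → Star (CanR L) x y → ∃ λ k → CanR^ k x y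
  Star⇒CanR^ ε            = 0 , ◇^-reach λ h → h
  Star⇒CanR^ (xRz ◅ z→⋆y) =
    let k , r = Star⇒CanR^ z→⋆y in suc k , CanR^-∘ (CanR⇒CanR^1 xRz) r

  CanR^-split : ∀ {k x y} → CanR^ (suc k) x y →
                Σ (CanPoint L) λ e → CanR L x e × CanR^ k e y
  CanR^-split {k} {x} {y} r =
    let e , xRe , ◇^ky⊆e = existence x ◇^k[y] ◇⋀∈x
    in  e , xRe , ◇^-reach λ ψ∈y → ◇^ky⊆e _ (_ , ψ∈y , refl)
    where
    ◇^k[y] : FormSet
    ◇^k[y] δ = ∃ λ ψ → y ∋ ψ × ◇^ k ψ ≡ δ

    witness : ∀ {δs} → All ◇^k[y] δs → ∃ λ ψ → y ∋ ψ × L (◇^ k ψ ⇒ ⋀ δs)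
    witness [] =
      ⊤' , ∋-theorem y ⊤-theorem , L-closed [] λ v w _ → Valuation.⇒⁺ v w λ _ → Valuation.⋀⁺ v w []
    witness ((ψ , ψ∈y , refl) ∷ rest) =
      let ψ′ , ψ′∈y , p = witness rest
      in  ψ ∧' ψ′ , ∋-∧⁺ y ψ∈y ψ′∈y ,
          L-closed (◇^-mono k ∧-elimˡ ∷ ◇^-mono k ∧-elimʳ ∷ p ∷ [])
            λ { v w (ab ∷ ac ∷ cd ∷ []) → let open Valuation v w in
                  ⇒⁺ λ a → ∧⁺ (⇒⁻ ab a) (⇒⁻ cd (⇒⁻ ac a)) }

    ◇⋀∈x : ∀ {δs} → All ◇^k[y] δs → x ∋ ◇ ⋀ δs
    ◇⋀∈x δs∈ = let ψ , ψ∈y , p = witness δs∈ in ∋-mono x (◇-mono p) (◇^∈ r ψ∈y)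

  CanR^-path : ∀ {k x y} → CanR^ (suc k) x y → Star (CanR L) x y
  CanR^-path {zero} {x} {y} r =
    let e , xRe , y⊆e = CanR^-split r
    in  (λ χ □χ∈x → ⊆⇒⊇ y e (λ _ → ◇^∈ y⊆e) χ (xRe χ □χ∈x)) ◅ ε
  CanR^-path {suc k} r =
    let e , xRe , eR^y = CanR^-split r in xRe ◅ CanR^-path eR^y

  -- y is closed under ∧, so witnesses against each single i ≤ k combine into one χ ∈ y.
  uniform-reach : ∀ k {x y} → (∀ {χ} → y ∋ χ → ¬ (∀ i → i ≤ k → ¬ x ∋ ◇^ i χ)) →
                  ¬ ¬ (∃ λ i → i ≤ k × CanR^ i x y)
  uniform-reach zero {x} reach none =
    none (0 , z≤n , ◇^-reach λ χ∈y → ∋-stable x λ χ∉x → reach χ∈y λ { _ z≤n → χ∉x })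
  uniform-reach (suc k) {x} {y} reach none = some-ψ-unreached λ (ψ , ψ∈y , ◇ψ∉x) →
    uniform-reach k (reach-with ψ∈y ◇ψ∉x) λ (i , i≤k , r) → none (i , m≤n⇒m≤1+n i≤k , r)
    where
    some-ψ-unreached : ¬ ¬ ∃ λ ψ → y ∋ ψ × ¬ x ∋ ◇^ (suc k) ψ
    some-ψ-unreached no-ψ =
      none (suc k , ≤-refl , ◇^-reach λ ψ∈y → ∋-stable x λ n → no-ψ (_ , ψ∈y , n))

    reach-with : ∀ {ψ} → y ∋ ψ → ¬ x ∋ ◇^ (suc k) ψ →
                 ∀ {χ} → y ∋ χ → ¬ (∀ i → i ≤ k → ¬ x ∋ ◇^ i χ)
    reach-with {ψ} ψ∈y ◇ψ∉x {χ} χ∈y none-χ = reach (∋-∧⁺ y χ∈y ψ∈y) unreached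
      where
      unreached : ∀ i → i ≤ suc k → ¬ x ∋ ◇^ i (χ ∧' ψ)
      unreached i i≤1+k h with m≤n⇒m<n∨m≡n i≤1+k
      ... | inj₁ (s≤s i≤k) = none-χ i i≤k (∋-mono x (◇^-mono i ∧-elimˡ) h)
      ... | inj₂ refl      = ◇ψ∉x (∋-mono x (◇^-mono (suc k) ∧-elimʳ) h)

  ∋-⋁◇⁺ : ∀ x {k i χ} → i ≤ k → x ∋ ◇^ i χ → x ∋ ⋁◇ k χ
  ∋-⋁◇⁺ x {zero}  z≤n h = h
  ∋-⋁◇⁺ x {suc k} i≤1+k h with m≤n⇒m<n∨m≡n i≤1+k
  ... | inj₁ (s≤s i≤k) = ∋-∨⁺ˡ x (∋-⋁◇⁺ x i≤k h)
  ... | inj₂ refl      = ∋-∨⁺ʳ x h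

  ∌-⋁◇ : ∀ x {k χ} → (∀ i → i ≤ k → ¬ x ∋ ◇^ i χ) → ¬ x ∋ ⋁◇ k χ
  ∌-⋁◇ x {zero}  none = none 0 z≤n
  ∌-⋁◇ x {suc k} none = ∌-∨ x (∌-⋁◇ x λ i i≤k → none i (m≤n⇒m≤1+n i≤k)) (none (suc k) ≤-refl)

module Pretransitivity {L : Logic} (N : NormalModalLogic L)
                       (m : ℕ) (ax : L (◇^ (suc m) p₀ ⇒ ⋁◇ m p₀)) where
  open NormalModalLogic N
  open NormalLogic N

  ◇^1+m⇒⋁◇ : ∀ χ → L (◇^ (suc m) χ ⇒ ⋁◇ m χ)
  ◇^1+m⇒⋁◇ χ = ≡-subst L (cong₂ _⇒_ (subst-◇^ σ (suc m) p₀) (subst-⋁◇ σ m p₀)) (usubst σ _ ax)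
    where
    σ : ℕ → Form
    σ _ = χ

  -- A window of m + 1 consecutive unreached powers ◇ⁱχ slides upwards by the axiom.
  bounded⇒unbounded : ∀ x {χ} → (∀ i → i ≤ m → ¬ x ∋ ◇^ i χ) → ∀ j → ¬ x ∋ ◇^ j χ
  bounded⇒unbounded x {χ} none j = window j 0 z≤n
    where
    window : ∀ s i → i ≤ m → ¬ x ∋ ◇^ i (◇^ s χ)
    window zero    = none
    window (suc s) i i≤m h with m≤n⇒m<n∨m≡n i≤m
    ... | inj₁ 1+i≤m = window s (suc i) 1+i≤m (≡-subst (x ∋_) (◇^-suc i _) h)
    ... | inj₂ refl  =
      ∌-⋁◇ x (window s) (∋-mono x (◇^1+m⇒⋁◇ _) (≡-subst (x ∋_) (◇^-suc m _) h))

  unreachable : Form → Form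
  unreachable χ = ¬' ⋁◇ m χ

  ∋-unreachable⁺ : ∀ x {χ} → (∀ i → i ≤ m → ¬ x ∋ ◇^ i χ) → x ∋ unreachable χ
  ∋-unreachable⁺ x none = ∋-¬⁺ x (∌-⋁◇ x none)

  ∋-unreachable⁻ : ∀ x {χ} → x ∋ unreachable χ → ∀ j → ¬ x ∋ ◇^ j χ
  ∋-unreachable⁻ x u = bounded⇒unbounded x λ i i≤m h → ∋-¬⁻ x u (∋-⋁◇⁺ x i≤m h)

  unreachable-persists : ∀ {n x y χ} → CanR^ n x y → x ∋ unreachable χ → y ∋ unreachable χ
  unreachable-persists {n} {x} {y} {χ} r u = ∋-unreachable⁺ y λ i _ h →
    ∋-unreachable⁻ x u (n + i) (≡-subst (x ∋_) (◇^-+ n i χ) (◇^∈ r h))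

-- Every suc n + i with i ≤ m divides (suc n + m)!, so K = 2 · (suc n + m)! ∸ suc n works.
uniform-return-length : ∀ n m → ∃ λ K → ∀ i → i ≤ m → ∃ λ t → K ≡ i + suc t * (suc n + i)
uniform-return-length n m = 2 * (suc n + m) ! ∸ suc n , decomposes
  where
  decomposes : ∀ i → i ≤ m → ∃ λ t → 2 * (suc n + m) ! ∸ suc n ≡ i + suc t * (suc n + i)
  decomposes i i≤m with ∣-trans (m∣m*n ((n + i) !)) (m≤n⇒m!∣n! (+-monoʳ-≤ (suc n) i≤m))
  ... | divides zero    eq = ⊥-elim (1+n≰n (≡-subst (1 ≤_) eq (1≤n! (suc n + m))))
  ... | divides (suc q) eq = q + q , (begin
    2 * (suc n + m) ! ∸ suc n                     ≡⟨ cong (λ F → 2 * F ∸ suc n) eq ⟩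
    2 * (suc q * (suc n + i)) ∸ suc n             ≡⟨ cong (_∸ suc n) (double q n i) ⟩
    i + suc (q + q) * (suc n + i) + suc n ∸ suc n ≡⟨ m+n∸n≡m _ (suc n) ⟩
    i + suc (q + q) * (suc n + i)                 ∎)
    where
    open ≡-Reasoning
    open +-*-Solver
    double : ∀ q n i → 2 * (suc q * (suc n + i)) ≡ i + suc (q + q) * (suc n + i) + suc n
    double = solve 3 (λ q n i → con 2 :* ((con 1 :+ q) :* (con 1 :+ n :+ i))
                             := i :+ (con 1 :+ (q :+ q)) :* (con 1 :+ n :+ i) :+ (con 1 :+ n))
                     refl

module MaximalElement {L : Logic} (N : NormalModalLogic L)
                      (m : ℕ) (ax : L (◇^ (suc m) p₀ ⇒ ⋁◇ m p₀))
                      (a : CanPoint L) (φ : Form)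
                      (b : CanPoint L) (aRb : CanR L a b) (φ∈b : carrier L b φ) where
  open NormalLogic N
  open Pretransitivity N m ax

  Γ₀ : FormSet
  Γ₀ = □⁻¹ a ∪ ｛ φ ｝

  Γ₀-consistent : Consistent L Γ₀
  Γ₀-consistent = Consistent-⊆ Γ₀⊆b (consistent b)
    where
    Γ₀⊆b : Γ₀ ⊆ carrier L b
    Γ₀⊆b χ (inj₁ □χ∈a) = aRb χ □χ∈a
    Γ₀⊆b χ (inj₂ refl) = φ∈b

  open Lindenbaum Γ₀ (unreachable ∘ decode)

  c : CanPoint L
  c = proj₁ (lindenbaum (limit-consistent Γ₀-consistent))

  limit⊆c : limit ⊆ carrier L c
  limit⊆c = proj₂ (lindenbaum (limit-consistent Γ₀-consistent))

  aRc : CanR L a c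
  aRc χ □χ∈a = limit⊆c χ (Γ⊆limit χ (inj₁ □χ∈a))

  φ∈c : c ∋ φ
  φ∈c = limit⊆c φ (Γ⊆limit φ (inj₂ refl))

  c-avoids-unreachable : ∀ {n d} → CanR L a d → d ∋ φ → CanR^ n c d →
                         ∀ {χ} → d ∋ unreachable χ → ¬ c ∋ χ
  c-avoids-unreachable {d = d} aRd φ∈d cR^d {χ} u χ∈c with decode-surjective χ
  ... | k , refl = ∋-unreachable⁻ c u∈c 0 χ∈c
    where
    stage+u⊆d : (stage k ∪ ｛ unreachable χ ｝) ⊆ carrier L d
    stage+u⊆d ψ (inj₂ refl) = u
    stage+u⊆d ψ (inj₁ h) with stage-origin k ψ h
    ... | inj₁ (inj₁ □ψ∈a) = aRd ψ □ψ∈a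
    ... | inj₁ (inj₂ refl) = φ∈d
    ... | inj₂ (j , refl)  = unreachable-persists cR^d (limit⊆c _ (k , h))

    u∈c : c ∋ unreachable χ
    u∈c = limit⊆c _ (limit-admits k (Consistent-⊆ stage+u⊆d (consistent d)))

  c-maximal : ∀ {n d} → CanR L a d → d ∋ φ → CanR^ (suc n) c d → Star (CanR L) d c
  c-maximal {n} {d} aRd φ∈d cR^d =
    -- instantiating K-decomposes at i = 0 exhibits K as a successor
    let _ , K≡1+ = K-decomposes 0 z≤n
    in  CanR^-path (≡-subst (λ k → CanR^ k d c) K≡1+ (CanR^-stable ¬¬dR^Kc))
    where
    K : ℕ
    K = proj₁ (uniform-return-length n m)

    K-decomposes : ∀ i → i ≤ m → ∃ λ t → K ≡ i + suc t * (suc n + i)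
    K-decomposes = proj₂ (uniform-return-length n m)

    around-the-cycle : ∃ (λ i → i ≤ m × CanR^ i d c) → CanR^ K d c
    around-the-cycle (i , i≤m , dR^c) =
      let t , K≡ = K-decomposes i i≤m
          cycle  = CanR^-∘ cR^d dR^c
      in  ≡-subst (λ k → CanR^ k d c) (sym K≡) (CanR^-∘ dR^c (CanR^-iterate cycle (suc t)))

    ¬¬dR^Kc : ¬ ¬ CanR^ K d c
    ¬¬dR^Kc = ¬¬-map around-the-cycle (uniform-reach m λ χ∈c none →
      c-avoids-unreachable aRd φ∈d cR^d (∋-unreachable⁺ d none) χ∈c)

corollary32 : (L : Logic) → NormalModalLogic L → Pretransitive L →
    (a : CanPoint L) (φ : Form) →
    Σ (CanPoint L) (λ b → CanR L a b × carrier L b φ) →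
    Σ (CanPoint L) (λ c → (CanR L a c × carrier L c φ) ×
      ((d : CanPoint L) → CanR L a d → carrier L d φ →
        CanR* L c d → CanR* L d c))
corollary32 L N (m , ax) a φ (b , aRb , φ∈b) = c , (aRc , φ∈c) , maximal
  where
  open NormalLogic N
  open MaximalElement N m ax a φ b aRb φ∈b

  maximal : (d : CanPoint L) → CanR L a d → carrier L d φ → CanR* L c d → CanR* L d c
  maximal d aRd φ∈d ε              = ε
  maximal d aRd φ∈d (cRe ◅ e→⋆d) =
    let _ , eR^d = Star⇒CanR^ e→⋆d in c-maximal aRd φ∈d (CanR^-∘ (CanR⇒CanR^1 cRe) eR^d)
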